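{- Let $n\ge1$ and let $\mathsf{LPO}^n$ denote the product of $n$ copies of $\mathsf{LPO}$ formed with the operation $\times$. Then $\mathsf{LPO}^n$ is not $n$-continuous.
   Context: A problem is a partial multivalued function $f:\subseteq \mathbb{N}^\mathbb{N} \rightrightarrows \mathbb{N}^\mathbb{N}$; $\mathrm{dom}(f)$ is the set of $x$ with $f(x)\neq\emptyset$. Fix a standard computable pairing $\langle x,y\rangle$ (and its iterates for tuples). For problems $f,g$, $f\times g$ has domain $\{\langle x,y\rangle : x\in\mathrm{dom}(f),\ y\in\mathrm{dom}(g)\}$ and $(f\times g)(\langle x,y\rangle)=\{\langle u,v\rangle : u\in f(x),\ v\in g(y)\}$. $\mathsf{LPO}:\mathbb{N}^\mathbb{N}\to\mathbb{N}^\mathbb{N}$ maps $x$ to the constant-$0$ sequence if $x$ has a zero entry and to the constant-$1$ sequence otherwise. A realizer of $f$ is a partial function $r:\subseteq\mathbb{N}^\mathbb{N}\to\mathbb{N}^\mathbb{N}$ with $r(x)\in f(x)$ for all $x\in\mathrm{dom}(f)$. For $k\in\mathbb{N}$, $f$ is $k$-continuous iff it has a realizer $r$ together with a partition $P$ of $\mathrm{dom}(r)$ with $|P|\le k$ such that the restriction of $r$ to each element of $P$ is continuous. -}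

module Defs where

open import Level using (0ℓ)
open import Data.Nat using (ℕ; zero; suc; _+_; _*_; _<_)
open import Data.Nat.DivMod using (_/_; _%_)
open import Data.Fin using (Fin)
open import Data.Product using (Σ; ∃; _×_; _,_)
open import Data.Sum using (_⊎_)
open import Relation.Nullary using (¬_)
open import Relation.Binary.PropositionalEquality using (_≡_; _≢_)

Baire : Set
Baire = ℕ → ℕ

_≈_ : Baire → Baire → Set
x ≈ y = ∀ k → x k ≡ y k

agree : ℕ → Baire → Baire → Set
agree m x y = ∀ k → k < m → x k ≡ y k

⟨_,_⟩ : Baire → Baire → Baire
⟨ x , y ⟩ n with n % 2
... | zero = x (n / 2)
... | suc _ = y (n / 2)

-- A problem f :⊆ ℕ^ℕ ⇉ ℕ^ℕ, given by the relation  "y ∈ f(x)"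
Problem : Set₁
Problem = Baire → Baire → Set

dom : Problem → Baire → Set
dom f x = ∃ λ y → f x y

_⊠_ : Problem → Problem → Problem
(f ⊠ g) z w = Σ Baire λ x → Σ Baire λ y → Σ Baire λ u → Σ Baire λ v →
  (z ≈ ⟨ x , y ⟩) × (w ≈ ⟨ u , v ⟩) × f x u × g y v

LPO : Problem
LPO x y = ((∃ λ k → x k ≡ 0) × (∀ j → y j ≡ 0))
        ⊎ ((∀ k → x k ≢ 0) × (∀ j → y j ≡ 1))

-- LPO^suc n = LPO^(n+1), the product of n+1 copies of LPO
LPO^suc : ℕ → Problem
LPO^suc zero = LPO
LPO^suc (suc n) = LPO^suc n ⊠ LPO

record PartialFun : Set₁ where
  field
    D   : Baire → Set
    app : (x : Baire) → D x → Baire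
    irr : ∀ x (d d' : D x) → app x d ≈ app x d'

record Realizer (f : Problem) : Set₁ where
  field
    pf : PartialFun
  open PartialFun pf public
  field
    realizes : ∀ x → dom f x → Σ (D x) λ d → f x (app x d)

-- a partition of dom(r) into (at most) k parts, indexed by Fin k
-- (parts may be empty, so the number of nonempty parts is ≤ k)
record Partition (r : PartialFun) (k : ℕ) : Set₁ where
  open PartialFun r
  field
    part     : Fin k → Baire → Set
    sub      : ∀ i x → part i x → D x
    cover    : ∀ x → D x → ∃ λ i → part i x
    disjoint : ∀ i j x → part i x → part j x → i ≡ j

ContinuousOn : (r : PartialFun) (A : Baire → Set) → (∀ x → A x → PartialFun.D r x) → Set
ContinuousOn r A inc = ∀ x (a : A x) (n : ℕ) → ∃ λ m → ∀ y (b : A y) →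
  agree m x y → agree n (PartialFun.app r x (inc x a)) (PartialFun.app r y (inc y b))

kContinuous : ℕ → Problem → Set₁
kContinuous k f = Σ (Realizer f) λ R → Σ (Partition (Realizer.pf R) k) λ P →
  ∀ i → ContinuousOn (Realizer.pf R) (Partition.part P i) (Partition.sub P i)

{-# OPTIONS --safe #-}
-- Near the all-ones point, an LPO^(n+1) realizer must answer "no zero" in every
-- coordinate, while arbitrarily close points whose last coordinate has a zero far out
-- must be answered "zero found" there; continuity on a piece forbids both in one piece.
-- So the points ⟨x , z⟩, with z fixed and having a late zero, avoid the piece of the
-- all-ones point, and restricting to them yields a realizer of LPO^n near its all-ones
-- point using one piece less.  After n such steps a single piece would have to make
-- LPO continuous at 1^ω, which it is not.
module Submission where

open import Defs
open import Data.Nat using (ℕ; zero; suc; _+_; _*_; _≤_; s≤s)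
open import Data.Nat.Properties using (≤-<-trans; <-≤-trans; m≤m+n; m≤n+m; *-monoˡ-<; n<1+n; 0≢1+n)
open import Data.Nat.DivMod using (_/_; _%_; m/n≤m; m*n/n≡m; m*n%n≡0; [m+kn]%n≡m%n; +-distrib-/-∣ʳ)
open import Data.Nat.Divisibility using (divides-refl)
open import Data.Fin using (Fin; punchOut)
open import Data.Fin.Properties using (punchOut-injective)
open import Data.Product using (∃; _×_; _,_; proj₁; proj₂)
open import Data.Sum using (inj₁; inj₂)
open import Function using (_∘_)
open import Relation.Nullary using (¬_)
open import Relation.Binary.PropositionalEquality

Extensional : Problem → Set
Extensional f = ∀ {x x′ u u′} → x ≈ x′ → u ≈ u′ → f x u → f x′ u′

agree-refl : ∀ {m x} → agree m x x
agree-refl _ _ = refl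

agree-sym : ∀ {m x y} → agree m x y → agree m y x
agree-sym a k k<m = sym (a k k<m)

agree-≤ : ∀ {m m′ x y} → m ≤ m′ → agree m′ x y → agree m x y
agree-≤ m≤m′ a k k<m = a k (<-≤-trans k<m m≤m′)

evens odds : Baire → Baire
evens w j = w (j * 2)
odds w j = w (1 + j * 2)

pair-evens : ∀ x y → evens ⟨ x , y ⟩ ≈ x
pair-evens x y j rewrite m*n%n≡0 j 2 ⦃ _ ⦄ = cong x (m*n/n≡m j 2)

pair-odds : ∀ x y → odds ⟨ x , y ⟩ ≈ y
pair-odds x y j rewrite [m+kn]%n≡m%n 1 j 2 ⦃ _ ⦄ =
  cong y (trans (+-distrib-/-∣ʳ 1 {d = 2} (divides-refl j)) (m*n/n≡m j 2))

agree-pair : ∀ {m x x′ y y′} → agree m x x′ → agree m y y′ → agree m ⟨ x , y ⟩ ⟨ x′ , y′ ⟩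
agree-pair {m} ax ay k k<m with k % 2
... | zero  = ax (k / 2) k/2<m
  where k/2<m = ≤-<-trans (m/n≤m k 2) k<m
... | suc _ = ay (k / 2) k/2<m
  where k/2<m = ≤-<-trans (m/n≤m k 2) k<m

agree-evens : ∀ {N w w′} → agree (N * 2) w w′ → agree N (evens w) (evens w′)
agree-evens a j j<N = a (j * 2) (*-monoˡ-< 2 j<N)

≈-evens : ∀ {w u v} → w ≈ ⟨ u , v ⟩ → evens w ≈ u
≈-evens {u = u} {v} e j = trans (e (j * 2)) (pair-evens u v j)

≈-odds : ∀ {w u v} → w ≈ ⟨ u , v ⟩ → odds w ≈ v
≈-odds {u = u} {v} e j = trans (e (1 + j * 2)) (pair-odds u v j)

dom-⊠ : ∀ {f g x y} → dom f x → dom g y → dom (f ⊠ g) ⟨ x , y ⟩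
dom-⊠ {x = x} {y} (u , fxu) (v , gyv) =
  ⟨ u , v ⟩ , x , y , u , v , (λ _ → refl) , (λ _ → refl) , fxu , gyv

⊠-extensional : ∀ {f g} → Extensional (f ⊠ g)
⊠-extensional ex eu (x , y , u , v , ez , ew , fxu , gyv) =
  x , y , u , v , (λ k → trans (sym (ex k)) (ez k)) , (λ k → trans (sym (eu k)) (ew k)) , fxu , gyv

⊠-split : ∀ {f g x y w} → Extensional f → Extensional g →
          (f ⊠ g) ⟨ x , y ⟩ w → f x (evens w) × g y (odds w)
⊠-split {x = x} {y} extf extg (x′ , y′ , u , v , ez , ew , fx′u , gy′v) =
  extf (λ j → sym (x≈x′ j)) (λ j → sym (≈-evens ew j)) fx′u ,
  extg (λ j → sym (y≈y′ j)) (λ j → sym (≈-odds ew j)) gy′v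
  where
  x≈x′ : x ≈ x′
  x≈x′ j = trans (sym (pair-evens x y j)) (≈-evens ez j)
  y≈y′ : y ≈ y′
  y≈y′ j = trans (sym (pair-odds x y j)) (≈-odds ez j)

ones zeros : Baire
ones _ = 1
zeros _ = 0

zeroAt : ℕ → Baire
zeroAt zero    zero    = 0
zeroAt zero    (suc j) = 1
zeroAt (suc p) zero    = 1
zeroAt (suc p) (suc j) = zeroAt p j

zeroAt-self : ∀ p → zeroAt p p ≡ 0
zeroAt-self zero    = refl
zeroAt-self (suc p) = zeroAt-self p

zeroAt-agree : ∀ p → agree p (zeroAt p) ones
zeroAt-agree (suc p) zero    _         = refl
zeroAt-agree (suc p) (suc k) (s≤s k<p) = zeroAt-agree p k k<p

LPO-ones : LPO ones ones
LPO-ones = inj₂ ((λ _ ()) , λ _ → refl)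

LPO-zeroAt : ∀ p → LPO (zeroAt p) zeros
LPO-zeroAt p = inj₁ ((p , zeroAt-self p) , λ _ → refl)

LPO-found : ∀ {x w} p → x p ≡ 0 → LPO x w → ∀ j → w j ≡ 0
LPO-found p xp≡0 (inj₁ (_ , w≡0)) j = w≡0 j
LPO-found p xp≡0 (inj₂ (x≢0 , _)) j with () ← x≢0 p xp≡0

LPO-ones⇒1 : ∀ {w} → LPO ones w → ∀ j → w j ≡ 1
LPO-ones⇒1 (inj₁ ((_ , ()) , _))
LPO-ones⇒1 (inj₂ (_ , w≡1)) = w≡1

LPO-extensional : Extensional LPO
LPO-extensional ex eu (inj₁ ((k , xk≡0) , w≡0)) =
  inj₁ ((k , trans (sym (ex k)) xk≡0) , λ j → trans (sym (eu j)) (w≡0 j))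
LPO-extensional ex eu (inj₂ (x≢0 , w≡1)) =
  inj₂ ((λ k → x≢0 k ∘ trans (ex k)) , λ j → trans (sym (eu j)) (w≡1 j))

onesPoint : ℕ → Baire
onesPoint zero    = ones
onesPoint (suc n) = ⟨ onesPoint n , ones ⟩

onesPoint∈dom : ∀ n → dom (LPO^suc n) (onesPoint n)
onesPoint∈dom zero    = ones , LPO-ones
onesPoint∈dom (suc n) = dom-⊠ (onesPoint∈dom n) (ones , LPO-ones)

LPO^suc-extensional : ∀ n → Extensional (LPO^suc n)
LPO^suc-extensional zero    = LPO-extensional
LPO^suc-extensional (suc n) = ⊠-extensional

record PiecewiseRealizer (f : Problem) (k : ℕ) (c : Baire) (m : ℕ) : Set₁ where
  field
    piece : ∀ x → dom f x → agree m x c → Fin k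
    out   : ∀ x → dom f x → agree m x c → Baire
    sound : ∀ x d a → f x (out x d a)
    cont  : ∀ x d a N → ∃ λ M → ∀ y d′ a′ → piece y d′ a′ ≡ piece x d a →
              agree M x y → agree N (out x d a) (out y d′ a′)

  jump⇒other-piece : ∀ (dc : dom f c) p → ∃ λ M → ∀ y d a → agree M c y →
    out y d a p ≢ out c dc agree-refl p → piece y d a ≢ piece c dc agree-refl
  jump⇒other-piece dc p with cont c dc agree-refl (suc p)
  ... | M , close = M , λ y d a c≈y jump same → jump (sym (close y d a same c≈y p (n<1+n p)))

kContinuous⇒piecewise : ∀ {k f} → kContinuous k f → ∀ c → PiecewiseRealizer f k c 0
kContinuous⇒piecewise {f = f} (R , P , cnt) c = record
  { piece = λ x d _ → proj₁ (cover x (realizer-dom x d))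
  ; out   = λ x d _ → app x (realizer-dom x d)
  ; sound = λ x d _ → proj₂ (realizes x d)
  ; cont  = continuity
  }
  where
  open Realizer R
  open Partition P
  realizer-dom : ∀ x → dom f x → D x
  realizer-dom x d = proj₁ (realizes x d)
  continuity : ∀ x (d : dom f x) (a : agree 0 x c) N → ∃ λ M → ∀ y d′ (a′ : agree 0 y c) →
    proj₁ (cover y (realizer-dom y d′)) ≡ proj₁ (cover x (realizer-dom x d)) →
    agree M x y → agree N (app x (realizer-dom x d)) (app y (realizer-dom y d′))
  continuity x d _ N with cover x (realizer-dom x d)
  ... | i , x∈i with cnt i x x∈i N
  ... | M , close = M , λ y d′ _ same x≈y k k<N →
    let y∈i = subst (λ j → part j y) same (proj₂ (cover y (realizer-dom y d′)))
    in  trans (sym (irr x (sub i x x∈i) (realizer-dom x d) k))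
          (trans (close y y∈i x≈y k k<N) (irr y (sub i y y∈i) (realizer-dom y d′) k))

drop-last : ∀ {f k c m} → Extensional f → dom f c →
            PiecewiseRealizer (f ⊠ LPO) (suc k) ⟨ c , ones ⟩ m →
            ∃ λ m′ → PiecewiseRealizer f k c m′
drop-last {f} {c = c} {m} extf dc R with jump⇒other-piece (dom-⊠ dc (ones , LPO-ones)) 1
  where open PiecewiseRealizer R
... | M , separate = m + M , record
  { piece = λ x d a → punchOut (new-piece x d a)
  ; out   = λ x d a → evens (out′ x d a)
  ; sound = λ x d a → proj₁ (⊠-split extf LPO-extensional (sound ⟨ x , z ⟩ (lift-dom d) (lift-agree a)))
  ; cont  = continuity
  }
  where
  open PiecewiseRealizer R
  z = zeroAt (m + M)
  dc′ = dom-⊠ dc (ones , LPO-ones)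
  lift-dom : ∀ {x} → dom f x → dom (f ⊠ LPO) ⟨ x , z ⟩
  lift-dom d = dom-⊠ d (zeros , LPO-zeroAt (m + M))
  lift-agree : ∀ {x} → agree (m + M) x c → agree m ⟨ x , z ⟩ ⟨ c , ones ⟩
  lift-agree a = agree-≤ (m≤m+n m M) (agree-pair a (zeroAt-agree (m + M)))
  out′ : ∀ x → dom f x → agree (m + M) x c → Baire
  out′ x d a = out ⟨ x , z ⟩ (lift-dom d) (lift-agree a)
  i₀ = piece ⟨ c , ones ⟩ dc′ agree-refl
  new-piece : ∀ x d a → i₀ ≢ piece ⟨ x , z ⟩ (lift-dom d) (lift-agree a)
  new-piece x d a = separate ⟨ x , z ⟩ (lift-dom d) (lift-agree a) close jump ∘ sym
    where
    close : agree M ⟨ c , ones ⟩ ⟨ x , z ⟩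
    close = agree-≤ (m≤n+m M m) (agree-sym (agree-pair a (zeroAt-agree (m + M))))
    found : out′ x d a 1 ≡ 0
    found = LPO-found (m + M) (zeroAt-self (m + M))
      (proj₂ (⊠-split extf LPO-extensional (sound ⟨ x , z ⟩ (lift-dom d) (lift-agree a)))) 0
    none : out ⟨ c , ones ⟩ dc′ agree-refl 1 ≡ 1
    none = LPO-ones⇒1 (proj₂ (⊠-split extf LPO-extensional (sound ⟨ c , ones ⟩ dc′ agree-refl))) 0
    jump : out′ x d a 1 ≢ out ⟨ c , ones ⟩ dc′ agree-refl 1
    jump e = 0≢1+n (trans (sym found) (trans e none))
  continuity : ∀ x d a N → ∃ λ M′ → ∀ y d′ a′ →
    punchOut (new-piece y d′ a′) ≡ punchOut (new-piece x d a) →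
    agree M′ x y → agree N (evens (out′ x d a)) (evens (out′ y d′ a′))
  continuity x d a N with cont ⟨ x , z ⟩ (lift-dom d) (lift-agree a) (N * 2)
  ... | M′ , close = M′ , λ y d′ a′ same x≈y →
    agree-evens (close ⟨ y , z ⟩ (lift-dom d′) (lift-agree a′)
      (punchOut-injective (new-piece y d′ a′) (new-piece x d a) same)
      (agree-pair x≈y agree-refl))

LPO-not-1-piecewise : ∀ m → ¬ PiecewiseRealizer LPO 1 ones m
LPO-not-1-piecewise m R with jump⇒other-piece (ones , LPO-ones) 0
  where open PiecewiseRealizer R
... | M , separate = separate z dz az close jump (Fin1-trivial _ _)
  where
  open PiecewiseRealizer R
  z = zeroAt (m + M)
  dz : dom LPO z
  dz = zeros , LPO-zeroAt (m + M)
  az : agree m z ones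
  az = agree-≤ (m≤m+n m M) (zeroAt-agree (m + M))
  close : agree M ones z
  close = agree-≤ (m≤n+m M m) (agree-sym (zeroAt-agree (m + M)))
  jump : out z dz az 0 ≢ out ones (ones , LPO-ones) agree-refl 0
  jump e = 0≢1+n (trans (sym (LPO-found (m + M) (zeroAt-self (m + M)) (sound z dz az) 0))
                   (trans e (LPO-ones⇒1 (sound ones (ones , LPO-ones) agree-refl) 0)))
  Fin1-trivial : (i j : Fin 1) → i ≡ j
  Fin1-trivial Fin.zero Fin.zero = refl

LPO^suc-not-piecewise : ∀ n m → ¬ PiecewiseRealizer (LPO^suc n) (suc n) (onesPoint n) m
LPO^suc-not-piecewise zero    m R = LPO-not-1-piecewise m R
LPO^suc-not-piecewise (suc n) m R
  with drop-last (LPO^suc-extensional n) (onesPoint∈dom n) R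
... | m′ , R′ = LPO^suc-not-piecewise n m′ R′

lemma4p8 : ∀ (n : ℕ) → ¬ kContinuous (suc n) (LPO^suc n)
lemma4p8 n K = LPO^suc-not-piecewise n 0 (kContinuous⇒piecewise K (onesPoint n))
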